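{- Let $p$ be a prime, $n\geq2$ and $t\geq1$ integers, and define $e\colon\{1,\dots,n\}\to\mathbb{Z}_{\geq1}$ by $e(i)=p^{t\lceil\log_p(n/i)\rceil}$. Let $I_e$ be the set of all $1\leq i\leq n$ such that $i'e(i')\geq ie(i)$ for every $1\leq i'\leq i$. Then $I_e=\{\lceil n/p^k\rceil : k\geq0\}$. -}

module Defs where

open import Data.Nat using (ℕ; zero; suc; _+_; _*_; _∸_; _^_; _≤?_; _≤_; NonZero)
open import Data.Product using (_×_)
open import Data.Nat.DivMod using (_/_)
open import Relation.Nullary using (yes; no)

⌈_/_⌉ : (a b : ℕ) → .{{NonZero b}} → ℕ
⌈ a / b ⌉ = (a + b ∸ 1) / b

-- ⌈ log_p (n / i) ⌉ for 1 ≤ i ≤ n and p ≥ 2: the least m ≥ 0 with p ^ m ≥ n / i,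
-- i.e. the least m with n ≤ i * p ^ m.  Found by linear search starting at m = 0,
-- with fuel n (the answer is < n whenever 1 ≤ i and p ≥ 2, so fuel never runs out
-- in the range where the definition is used).
clogSearch : (p n i fuel m : ℕ) → ℕ
clogSearch p n i zero       m = m
clogSearch p n i (suc fuel) m with n ≤? i * p ^ m
... | yes _ = m
... | no  _ = clogSearch p n i fuel (suc m)

⌈log_[_/_]⌉ : (p n i : ℕ) → ℕ
⌈log p [ n / i ]⌉ = clogSearch p n i n 0

e : (p t n i : ℕ) → ℕ
e p t n i = p ^ (t * ⌈log p [ n / i ]⌉)

InIe : (p t n i : ℕ) → Set
InIe p t n i = (1 ≤ i × i ≤ n) × (∀ i' → 1 ≤ i' → i' ≤ i → i * e p t n i ≤ i' * e p t n i')

{-# OPTIONS --safe #-}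

-- Write M(i) = ⌈log_p(n/i)⌉ and a(k) = ⌈n/p^k⌉.  Both are the extremal solutions of
-- n ≤ i·p^k, so a(k) ≤ i ⟺ M(i) ≤ k for i ≥ 1.  In particular j = a(M(i)) ≤ i and
-- M(j) ≤ M(i), so j·e(j) ≤ j·e(i) < i·e(i) unless j = i: every i ∈ I_e is some a(k).
-- Conversely, for i = a(k) and 1 ≤ i' ≤ i put m = M(i), d = M(i') − m ≥ 0; since
-- n ≤ i'p^d·p^m, minimality gives i ≤ a(m) ≤ i'p^d, and with t ≥ 1
-- i·e(i) ≤ i'p^(td)·p^(tm) = i'·e(i').
module Submission where

open import Data.Empty using (⊥-elim)
open import Data.Nat
  using (ℕ; zero; suc; _+_; _*_; _∸_; _^_; _≤_; _<_; _≥_; _≤?_; z≤n; z<s; s≤s; s≤s⁻¹; NonZero; >-nonZero; nonTrivial⇒n>1)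
open import Data.Nat.DivMod using (_/_; _%_; m≡m%n+[m/n]*n; m%n<n; m<n*o⇒m/o<n; m≥n⇒m/n>0)
open import Data.Nat.Primality using (Prime; prime⇒nonZero; prime⇒nonTrivial)
open import Data.Nat.Properties
open import Data.Product using (∃-syntax; _×_; _,_)
open import Data.Sum using (inj₁; inj₂)
open import Relation.Binary.PropositionalEquality using (_≡_; refl; cong; subst)
open import Relation.Nullary using (yes; no)

open import Defs

⌈/⌉-least : ∀ n q .{{_ : NonZero q}} x → n ≤ x * q → ⌈ n / q ⌉ ≤ x
⌈/⌉-least n (suc q) x n≤xq = s≤s⁻¹ (m<n*o⇒m/o<n (begin-strict
  n + suc q ∸ 1    ≡⟨ cong (_∸ 1) (+-suc n q) ⟩
  n + q            ≤⟨ +-monoˡ-≤ q n≤xq ⟩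
  x * suc q + q    ≡⟨ +-comm (x * suc q) q ⟩
  q + x * suc q    <⟨ n<1+n _ ⟩
  suc x * suc q    ∎))
  where open ≤-Reasoning

n≤⌈n/q⌉*q : ∀ n q .{{_ : NonZero q}} → n ≤ ⌈ n / q ⌉ * q
n≤⌈n/q⌉*q n (suc q) = +-cancelˡ-≤ q n (⌈ n / suc q ⌉ * suc q) q+n≤
  where
  a = n + suc q ∸ 1
  q+n≤ : q + n ≤ q + ⌈ n / suc q ⌉ * suc q
  q+n≤ = begin
    q + n                         ≡⟨ +-comm q n ⟩
    n + q                         ≡⟨ cong (_∸ 1) (+-suc n q) ⟨
    a                             ≡⟨ m≡m%n+[m/n]*n a (suc q) ⟩
    a % suc q + a / suc q * suc q ≤⟨ +-monoˡ-≤ _ (s≤s⁻¹ (m%n<n a (suc q))) ⟩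
    q + a / suc q * suc q         ∎
    where open ≤-Reasoning

⌈/⌉-positive : ∀ n q .{{_ : NonZero q}} → 1 ≤ n → 1 ≤ ⌈ n / q ⌉
⌈/⌉-positive (suc n) (suc q) _ = m≥n⇒m/n>0 (m≤n+m (suc q) n)

⌈n/q⌉≤n : ∀ n q .{{_ : NonZero q}} → ⌈ n / q ⌉ ≤ n
⌈n/q⌉≤n n q = ⌈/⌉-least n q n (m≤m*n n q)

⌈/⌉-monoʳ-≥ : ∀ n {q r} .{{_ : NonZero q}} .{{_ : NonZero r}} → q ≥ r → ⌈ n / q ⌉ ≤ ⌈ n / r ⌉
⌈/⌉-monoʳ-≥ n {q} {r} q≥r =
  ⌈/⌉-least n q _ (≤-trans (n≤⌈n/q⌉*q n r) (*-monoʳ-≤ ⌈ n / r ⌉ q≥r))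

n<m^n : ∀ m → 1 < m → ∀ n → n < m ^ n
n<m^n m 1<m zero    = z<s
n<m^n m 1<m (suc n) = ≤-<-trans (n<m^n m 1<m n) (^-monoʳ-< m 1<m (n<1+n n))

module _ (p n i : ℕ) where

  clogSearch-least : ∀ fuel m k → m ≤ k → n ≤ i * p ^ k → clogSearch p n i fuel m ≤ k
  clogSearch-least zero       m k m≤k _ = m≤k
  clogSearch-least (suc fuel) m k m≤k n≤ip^k with n ≤? i * p ^ m
  ... | yes _ = m≤k
  ... | no n≰ip^m with m≤n⇒m<n∨m≡n m≤k
  ...   | inj₁ m<k  = clogSearch-least fuel (suc m) k m<k n≤ip^k
  ...   | inj₂ refl = ⊥-elim (n≰ip^m n≤ip^k)

  clogSearch-sound : ∀ fuel m → n ≤ i * p ^ (m + fuel) → n ≤ i * p ^ clogSearch p n i fuel m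
  clogSearch-sound zero       m h = subst (λ k → n ≤ i * p ^ k) (+-identityʳ m) h
  clogSearch-sound (suc fuel) m h with n ≤? i * p ^ m
  ... | yes n≤ip^m = n≤ip^m
  ... | no _       = clogSearch-sound fuel (suc m) (subst (λ k → n ≤ i * p ^ k) (+-suc m fuel) h)

  ⌈log⌉-least : ∀ k → n ≤ i * p ^ k → ⌈log p [ n / i ]⌉ ≤ k
  ⌈log⌉-least k = clogSearch-least n 0 k z≤n

  ⌈log⌉-sound : 1 < p → 1 ≤ i → n ≤ i * p ^ ⌈log p [ n / i ]⌉
  ⌈log⌉-sound 1<p 1≤i = clogSearch-sound n 0
    (≤-trans (<⇒≤ (n<m^n p 1<p n)) (m≤n*m (p ^ n) i {{>-nonZero 1≤i}}))

*^-shift-≤ : ∀ p .{{_ : NonZero p}} {t} → 1 ≤ t → ∀ {i} i' d m →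
             i ≤ i' * p ^ d → i * p ^ (t * m) ≤ i' * p ^ (t * (d + m))
*^-shift-≤ p {t} 1≤t {i} i' d m i≤i'p^d = begin
  i * p ^ (t * m)                   ≤⟨ *-monoˡ-≤ (p ^ (t * m)) i≤i'p^d ⟩
  i' * p ^ d * p ^ (t * m)          ≤⟨ *-monoˡ-≤ (p ^ (t * m)) (*-monoʳ-≤ i' p^d≤p^td) ⟩
  i' * p ^ (t * d) * p ^ (t * m)    ≡⟨ *-assoc i' _ _ ⟩
  i' * (p ^ (t * d) * p ^ (t * m))  ≡⟨ cong (i' *_) (^-distribˡ-+-* p (t * d) (t * m)) ⟨
  i' * p ^ (t * d + t * m)          ≡⟨ cong (λ x → i' * p ^ x) (*-distribˡ-+ t d m) ⟨
  i' * p ^ (t * (d + m))            ∎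
  where
  open ≤-Reasoning
  p^d≤p^td : p ^ d ≤ p ^ (t * d)
  p^d≤p^td = ^-monoʳ-≤ p (m≤n*m d t {{>-nonZero 1≤t}})

module _ {p : ℕ} (1<p : 1 < p) (n : ℕ) where

  private instance
    p≢0 : NonZero p
    p≢0 = >-nonZero (<-trans z<s 1<p)

  ⌈n/p^_⌉ : ℕ → ℕ
  ⌈n/p^ k ⌉ = ⌈ n / p ^ k ⌉ {{m^n≢0 p k}}

  ⌈n/p^⌉-positive : 1 ≤ n → ∀ k → 1 ≤ ⌈n/p^ k ⌉
  ⌈n/p^⌉-positive 1≤n k = ⌈/⌉-positive n (p ^ k) {{m^n≢0 p k}} 1≤n

  ⌈n/p^⌉≤n : ∀ k → ⌈n/p^ k ⌉ ≤ n
  ⌈n/p^⌉≤n k = ⌈n/q⌉≤n n (p ^ k) {{m^n≢0 p k}}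

  ⌈n/p^⌉-antimono : ∀ {k l} → k ≤ l → ⌈n/p^ l ⌉ ≤ ⌈n/p^ k ⌉
  ⌈n/p^⌉-antimono {k} {l} k≤l = ⌈/⌉-monoʳ-≥ n {{m^n≢0 p l}} {{m^n≢0 p k}} (^-monoʳ-≤ p k≤l)

  ⌈n/p^⌉-least : ∀ k x → n ≤ x * p ^ k → ⌈n/p^ k ⌉ ≤ x
  ⌈n/p^⌉-least k = ⌈/⌉-least n (p ^ k) {{m^n≢0 p k}}

  ⌈log⌉-antimono : ∀ {i i'} → 1 ≤ i' → i' ≤ i → ⌈log p [ n / i ]⌉ ≤ ⌈log p [ n / i' ]⌉
  ⌈log⌉-antimono {i} {i'} 1≤i' i'≤i =
    ⌈log⌉-least p n i _ (≤-trans (⌈log⌉-sound p n i' 1<p 1≤i') (*-monoˡ-≤ _ i'≤i))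

  ⌈n/p^⌈log⌉⌉≤ : ∀ {i} → 1 ≤ i → ⌈n/p^ ⌈log p [ n / i ]⌉ ⌉ ≤ i
  ⌈n/p^⌈log⌉⌉≤ {i} 1≤i = ⌈n/p^⌉-least ⌈log p [ n / i ]⌉ i (⌈log⌉-sound p n i 1<p 1≤i)

  ⌈log⌈n/p^⌉⌉≤ : ∀ k → ⌈log p [ n / ⌈n/p^ k ⌉ ]⌉ ≤ k
  ⌈log⌈n/p^⌉⌉≤ k = ⌈log⌉-least p n _ k (n≤⌈n/q⌉*q n (p ^ k) {{m^n≢0 p k}})

  InIe⇒≡⌈n/p^⌈log⌉⌉ : ∀ t {i} → 1 ≤ n → InIe p t n i → i ≡ ⌈n/p^ ⌈log p [ n / i ]⌉ ⌉
  InIe⇒≡⌈n/p^⌈log⌉⌉ t {i} 1≤n ((1≤i , _) , minimal) = ≤-antisym i≤j j≤i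
    where
    k = ⌈log p [ n / i ]⌉
    j = ⌈n/p^ k ⌉
    j≤i : j ≤ i
    j≤i = ⌈n/p^⌈log⌉⌉≤ 1≤i
    j<i⇒j*e[j]<i*e[i] : j < i → j * e p t n j < i * e p t n i
    j<i⇒j*e[j]<i*e[i] j<i = begin-strict
      j * p ^ (t * ⌈log p [ n / j ]⌉) ≤⟨ *-monoʳ-≤ j (^-monoʳ-≤ p (*-monoʳ-≤ t (⌈log⌈n/p^⌉⌉≤ k))) ⟩
      j * p ^ (t * k)                 <⟨ *-monoˡ-< (p ^ (t * k)) {{m^n≢0 p (t * k)}} j<i ⟩
      i * p ^ (t * k)                 ∎
      where open ≤-Reasoning
    i≤j : i ≤ j
    i≤j = ≮⇒≥ λ j<i → <⇒≱ (j<i⇒j*e[j]<i*e[i] j<i) (minimal j (⌈n/p^⌉-positive 1≤n k) j≤i)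

  ⌈n/p^⌉∈Ie : ∀ t → 1 ≤ t → 1 ≤ n → ∀ k → InIe p t n ⌈n/p^ k ⌉
  ⌈n/p^⌉∈Ie t 1≤t 1≤n k = (⌈n/p^⌉-positive 1≤n k , ⌈n/p^⌉≤n k) , minimal
    where
    i = ⌈n/p^ k ⌉
    m = ⌈log p [ n / i ]⌉
    minimal : ∀ i' → 1 ≤ i' → i' ≤ i → i * e p t n i ≤ i' * e p t n i'
    minimal i' 1≤i' i'≤i =
      subst (λ x → i * p ^ (t * m) ≤ i' * p ^ (t * x)) d+m≡j (*^-shift-≤ p 1≤t i' d m i≤i'*p^d)
      where
      j = ⌈log p [ n / i' ]⌉
      d = j ∸ m
      d+m≡j : d + m ≡ j
      d+m≡j = m∸n+n≡m (⌈log⌉-antimono 1≤i' i'≤i)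
      n≤i'*p^d*p^m : n ≤ i' * p ^ d * p ^ m
      n≤i'*p^d*p^m = begin
        n                    ≤⟨ ⌈log⌉-sound p n i' 1<p 1≤i' ⟩
        i' * p ^ j           ≡⟨ cong (λ x → i' * p ^ x) d+m≡j ⟨
        i' * p ^ (d + m)     ≡⟨ cong (i' *_) (^-distribˡ-+-* p d m) ⟩
        i' * (p ^ d * p ^ m) ≡⟨ *-assoc i' _ _ ⟨
        i' * p ^ d * p ^ m   ∎
        where open ≤-Reasoning
      i≤i'*p^d : i ≤ i' * p ^ d
      i≤i'*p^d = ≤-trans (⌈n/p^⌉-antimono (⌈log⌈n/p^⌉⌉≤ k)) (⌈n/p^⌉-least m _ n≤i'*p^d*p^m)

proposition2p5 : (p n t : ℕ) → (pp : Prime p) → 2 ≤ n → 1 ≤ t →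
    ∀ i → (InIe p t n i → ∃[ k ] i ≡ ⌈_/_⌉ n (p ^ k) {{m^n≢0 p k {{prime⇒nonZero pp}}}})
      × ((∃[ k ] i ≡ ⌈_/_⌉ n (p ^ k) {{m^n≢0 p k {{prime⇒nonZero pp}}}}) → InIe p t n i)
proposition2p5 p n t pp 2≤n 1≤t i =
  (λ i∈Ie → ⌈log p [ n / i ]⌉ , InIe⇒≡⌈n/p^⌈log⌉⌉ 1<p n t 1≤n i∈Ie) ,
  λ { (k , refl) → ⌈n/p^⌉∈Ie 1<p n t 1≤t 1≤n k }
  where
  1<p : 1 < p
  1<p = nonTrivial⇒n>1 p {{prime⇒nonTrivial pp}}
  1≤n : 1 ≤ n
  1≤n = ≤-trans (s≤s z≤n) 2≤n
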